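{- Let $p$ be a prime and $D=\{\mathbf{d}_1,\dots,\mathbf{d}_n\}\subset\mathbb{N}^r\setminus\{0\}$ a finite nonempty set, $\mathbf{d}_i=(d_{i1},\dots,d_{ir})$, not contained in any coordinate hyperplane $\{x_j=0\}$. For $1\le j\le r$ let $D_j=\sum_{i=1}^n d_{ij}$. Then the set $\left\{\frac{\sigma_p(D,m)}{m}\right\}_{m\ge1}$ has a minimum, and this minimum is attained for at least one $m\le\prod_{j=1}^rD_j$.
   Context: $\sigma_p(N)$ is the sum of the base-$p$ digits of the nonnegative integer $N$. For $m\ge1$, $E_D(m)$ is the set of $U=(u_1,\dots,u_n)\in\{0,\dots,p^m-1\}^n\setminus\{(0,\dots,0)\}$ with $\sum_iu_i\mathbf{d}_i\equiv0\pmod{p^m-1}$ coordinatewise and $\sum_iu_id_{ij}>0$ for every $j$; $\sigma_p(U)=\sum_i\sigma_p(u_i)$ and $\sigma_p(D,m)=\min_{U\in E_D(m)}\sigma_p(U)$. -}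

module Defs where

open import Data.Nat using (ℕ; zero; suc; _+_; _*_; _∸_; _^_; _≤_; _<_; NonZero)
open import Data.Nat.DivMod using (_/_; _%_)
open import Data.Nat.Divisibility using (_∣_)
open import Data.Fin using (Fin; zero; suc)
open import Data.Vec using (Vec; lookup)
open import Data.Product using (Σ; _×_; _,_)
open import Relation.Nullary using (¬_)
open import Relation.Binary.PropositionalEquality using (_≡_)

ΣFin : ∀ n → (Fin n → ℕ) → ℕ
ΣFin zero    f = 0
ΣFin (suc n) f = f zero + ΣFin n (λ i → f (suc i))

ΠFin : ∀ n → (Fin n → ℕ) → ℕ
ΠFin zero    f = 1
ΠFin (suc n) f = f zero * ΠFin n (λ i → f (suc i))

-- σ_p(N): sum of the base-p digits of N (fuel N suffices when p ≥ 2)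
digitSumAux : (p : ℕ) .{{_ : NonZero p}} → ℕ → ℕ → ℕ
digitSumAux p zero    N = 0
digitSumAux p (suc f) N = N % p + digitSumAux p f (N / p)

σp : (p : ℕ) .{{_ : NonZero p}} → ℕ → ℕ
σp p N = digitSumAux p N N

-- D = {d_1,…,d_n} ⊂ ℕ^r, given as an indexed family; d i j = d_{ij}
entry : ∀ {n r} → (Fin n → Vec ℕ r) → Fin n → Fin r → ℕ
entry D i j = lookup (D i) j

colSum : ∀ {n r} → (Fin n → Vec ℕ r) → Fin r → ℕ
colSum {n} D j = ΣFin n (λ i → entry D i j)

weighted : ∀ {n r} → (Fin n → Vec ℕ r) → (Fin n → ℕ) → Fin r → ℕ
weighted {n} D U j = ΣFin n (λ i → U i * entry D i j)

InE : ∀ {n r} (p : ℕ) → (Fin n → Vec ℕ r) → ℕ → (Fin n → ℕ) → Set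
InE {n} {r} p D m U =
  (∀ i → U i < p ^ m) ×
  ¬ (∀ i → U i ≡ 0) ×
  (∀ j → (p ^ m ∸ 1) ∣ weighted D U j) ×
  (∀ j → 0 < weighted D U j)

σpU : ∀ {n} (p : ℕ) .{{_ : NonZero p}} → (Fin n → ℕ) → ℕ
σpU {n} p U = ΣFin n (λ i → σp p (U i))

IsσpDm : ∀ {n r} (p : ℕ) .{{_ : NonZero p}} → (Fin n → Vec ℕ r) → ℕ → ℕ → Set
IsσpDm {n} p D m s =
  (Σ (Fin n → ℕ) λ U → InE p D m U × σpU p U ≡ s) ×
  (∀ U → InE p D m U → s ≤ σpU p U)

module Submission where

-- Proof idea (p ≥ 2 suffices; primality is only used to exclude p = 0, 1).
-- Writing each U ∈ E_D(m) in base p, its m digit vectors a⁽⁰⁾,…,a⁽ᵐ⁻¹⁾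
-- form a closed walk of length m in a finite "digit graph": the states are
-- the vectors q with 1 ≤ q_j ≤ D_j, and digit a leads from q to q' when
-- p · q' = q + Σ_i a_i d_i.  Conversely every closed walk of positive length
-- L gives an element of E_D(L), and σ_p(U) is the total digit sum (weight)
-- of the walk.  A closed walk longer than the number N = Π_j D_j of states
-- repeats a state and splits into two closed walks; by the mediant
-- inequality one of them has weight/length ratio at most that of the whole.
-- Hence every ratio σ_p(U)/m is bounded below by the ratio of a closed walk
-- of length between 1 and N.  Among the finitely many (decidable) such
-- ratios there is a least one s₀/m₀, which then is σ_p(D,m₀)/m₀ and the
-- minimum of all σ_p(D,m)/m.

open import Defs
open import Data.Nat using (ℕ; suc; _*_; _≤_; _<_; NonZero)
open import Data.Nat.Primality using (Prime)
open import Data.Fin using (Fin)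
open import Data.Vec using (Vec; replicate)
open import Data.Product using (Σ; _×_)
open import Relation.Binary.PropositionalEquality using (_≡_; _≢_)
open import Function.Definitions using (Injective)

open import Data.Nat
open import Data.Nat.Properties
open import Data.Nat.DivMod
open import Data.Nat.Divisibility using (_∣_; _∣?_; divides)
open import Data.Nat.Primality using (¬prime[0]; ¬prime[1])
open import Data.Nat.Tactic.RingSolver using (solve-∀)
open import Data.Fin as F using (zero; suc; fromℕ<; combine; toℕ)
open import Data.Fin.Properties using (all?; toℕ-fromℕ<; combine-injective; pigeonhole)
open import Data.Vec using (lookup; tabulate; []; _∷_)
open import Data.Vec.Properties using (lookup∘tabulate; tabulate∘lookup; tabulate-cong; ≡-dec)
open import Data.List as L using (List; []; _∷_; length; _++_; upTo; cartesianProduct)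
open import Data.List.Properties using (length-++)
open import Data.List.Membership.Propositional using (_∈_)
open import Data.List.Membership.Propositional.Properties
  using (∈-lookup; ∈-upTo⁺; ∈-cartesianProduct⁺)
open import Data.List.Relation.Unary.Any using (here; there)
open import Data.Product using (∃; _,_; proj₁; proj₂; uncurry)
open import Data.Sum using (_⊎_; inj₁; inj₂)
open import Data.Empty using (⊥-elim)
open import Relation.Nullary using (¬_; Dec; yes; no)
open import Relation.Nullary.Decidable using (_×-dec_; ¬?; map′)
open import Relation.Binary.PropositionalEquality
  using (refl; sym; trans; cong; cong₂; subst; subst₂; module ≡-Reasoning)
import Data.List.Membership.DecPropositional as DecMembership
import Data.List.Relation.Unary.All as All
open import Data.List.Relation.Unary.Unique.Propositional using (Unique; []; _∷_)
open import Data.List.Relation.Unary.All.Properties using (¬Any⇒All¬)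

ΣFin-cong : ∀ k {f g : Fin k → ℕ} → (∀ i → f i ≡ g i) → ΣFin k f ≡ ΣFin k g
ΣFin-cong zero    e = refl
ΣFin-cong (suc k) e = cong₂ _+_ (e zero) (ΣFin-cong k (λ i → e (suc i)))

ΣFin-zero : ∀ k {f : Fin k → ℕ} → (∀ i → f i ≡ 0) → ΣFin k f ≡ 0
ΣFin-zero zero    e = refl
ΣFin-zero (suc k) e rewrite e zero = ΣFin-zero k (λ i → e (suc i))

ΣFin-const : ∀ k c → ΣFin k (λ _ → c) ≡ k * c
ΣFin-const zero    c = refl
ΣFin-const (suc k) c = cong (c +_) (ΣFin-const k c)

ΣFin-+ : ∀ k (f g : Fin k → ℕ) → ΣFin k (λ i → f i + g i) ≡ ΣFin k f + ΣFin k g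
ΣFin-+ zero    f g = refl
ΣFin-+ (suc k) f g =
  trans (cong (f zero + g zero +_) (ΣFin-+ k (λ i → f (suc i)) (λ i → g (suc i))))
        (+-+-interchange (f zero) (g zero) _ _)
  where
    +-+-interchange : ∀ a b c d → a + b + (c + d) ≡ a + c + (b + d)
    +-+-interchange = solve-∀

ΣFin-* : ∀ k c (f : Fin k → ℕ) → ΣFin k (λ i → c * f i) ≡ c * ΣFin k f
ΣFin-* zero    c f = sym (*-zeroʳ c)
ΣFin-* (suc k) c f =
  trans (cong (c * f zero +_) (ΣFin-* k c (λ i → f (suc i))))
        (sym (*-distribˡ-+ c (f zero) _))

ΣFin-mono : ∀ k {f g : Fin k → ℕ} → (∀ i → f i ≤ g i) → ΣFin k f ≤ ΣFin k g
ΣFin-mono zero    e = z≤n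
ΣFin-mono (suc k) e = +-mono-≤ (e zero) (ΣFin-mono k (λ i → e (suc i)))

ΣFin-summand : ∀ k (f : Fin k → ℕ) i → f i ≤ ΣFin k f
ΣFin-summand (suc k) f zero    = m≤m+n _ _
ΣFin-summand (suc k) f (suc i) = ≤-trans (ΣFin-summand k (λ i → f (suc i)) i) (m≤n+m _ _)

ΠFin-positive : ∀ k (f : Fin k → ℕ) → (∀ i → 1 ≤ f i) → 1 ≤ ΠFin k f
ΠFin-positive zero    f h = ≤-refl
ΠFin-positive (suc k) f h = *-mono-≤ (h zero) (ΠFin-positive k _ (λ i → h (suc i)))

module Digits (k : ℕ) where

  p : ℕ
  p = suc (suc k)

  digitSumAux-zero : ∀ f → digitSumAux p f 0 ≡ 0
  digitSumAux-zero zero    = refl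
  digitSumAux-zero (suc f) = digitSumAux-zero f

  /p-< : ∀ f N → N < p ^ suc f → N / p < p ^ f
  /p-< f N lt = m<n*o⇒m/o<n (subst (N <_) (*-comm p (p ^ f)) lt)

  digitSumAux-fuel : ∀ f g N → N < p ^ f → N < p ^ g →
                     digitSumAux p f N ≡ digitSumAux p g N
  digitSumAux-fuel f       g       zero    _ _ = trans (digitSumAux-zero f) (sym (digitSumAux-zero g))
  digitSumAux-fuel zero    g       (suc N) (s≤s ()) _
  digitSumAux-fuel (suc f) zero    (suc N) _ (s≤s ())
  digitSumAux-fuel (suc f) (suc g) (suc N) a b =
    cong (suc N % p +_) (digitSumAux-fuel f g (suc N / p) (/p-< f (suc N) a) (/p-< g (suc N) b))

  σp-fuel : ∀ f N → N < p ^ f → σp p N ≡ digitSumAux p f N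
  σp-fuel f N lt = digitSumAux-fuel N f N (n<m^n N) lt
    where
      n<m^n : ∀ N → N < p ^ N
      n<m^n zero    = s≤s z≤n
      n<m^n (suc N) = begin-strict
          suc N               ≤⟨ n<m^n N ⟩
          p ^ N               <⟨ m<m+n (p ^ N) (m^n>0 p N) ⟩
          p ^ N + p ^ N       ≤⟨ +-monoʳ-≤ (p ^ N) (m≤m+n (p ^ N) _) ⟩
          p * p ^ N           ∎
        where open ≤-Reasoning

  euclid : ∀ h → h ≡ h % p + p * (h / p)
  euclid h = trans (m≡m%n+[m/n]*n h p) (cong (h % p +_) (*-comm (h / p) p))

  lowest-digit : ∀ a b → a < p → (a + p * b) % p ≡ a
  lowest-digit a b a<p = trans (cong (λ x → (a + x) % p) (*-comm p b))
                               (trans ([m+kn]%n≡m%n a b p) (m<n⇒m%n≡m a<p))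

  higher-digits : ∀ a b → a < p → (a + p * b) / p ≡ b
  higher-digits a b a<p = begin
      (a + p * b) / p     ≡⟨ cong (λ x → (a + x) / p) (*-comm p b) ⟩
      (a + b * p) / p     ≡⟨ +-distrib-/-∣ʳ a (divides b refl) ⟩
      a / p + b * p / p   ≡⟨ cong₂ _+_ (m<n⇒m/n≡0 a<p) (m*n/n≡m b p) ⟩
      b                   ∎
    where open ≡-Reasoning

  digitSum-step : ∀ f a b → a < p → digitSumAux p (suc f) (a + p * b) ≡ a + digitSumAux p f b
  digitSum-step f a b a<p =
    cong₂ _+_ (lowest-digit a b a<p) (cong (digitSumAux p f) (higher-digits a b a<p))

  1≤p^L∸1 : ∀ L → 1 ≤ L → 1 ≤ p ^ L ∸ 1
  1≤p^L∸1 (suc L) _ =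
    ∸-monoˡ-≤ 1 (≤-trans (s≤s (s≤s z≤n)) (m≤m*n p (p ^ L) {{>-nonZero (m^n>0 p L)}}))

  digit-cons-< : ∀ L a b → a < p → b < p ^ L → a + p * b < p ^ suc L
  digit-cons-< L a b a<p b<p^L = begin-strict
      a + p * b         <⟨ +-monoˡ-< (p * b) a<p ⟩
      p + p * b         ≡⟨ cong (_+ p * b) (sym (*-identityʳ p)) ⟩
      p * 1 + p * b     ≡⟨ sym (*-distribˡ-+ p 1 b) ⟩
      p * suc b         ≤⟨ *-monoʳ-≤ p b<p^L ⟩
      p * p ^ L         ∎
    where open ≤-Reasoning

  σp-digit-cons : ∀ L a b → a < p → b < p ^ L → σp p (a + p * b) ≡ a + σp p b
  σp-digit-cons L a b a<p b<p^L = begin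
      σp p (a + p * b)                     ≡⟨ σp-fuel (suc L) _ (digit-cons-< L a b a<p b<p^L) ⟩
      digitSumAux p (suc L) (a + p * b)    ≡⟨ digitSum-step L a b a<p ⟩
      a + digitSumAux p L b                ≡⟨ cong (a +_) (sym (σp-fuel L b b<p^L)) ⟩
      a + σp p b                           ∎
    where open ≡-Reasoning

-- Comparing fractions: (s , L) ≼ (s' , L') means s / L ≤ s' / L'.

_≼_ : ℕ × ℕ → ℕ × ℕ → Set
(s , L) ≼ (s' , L') = s * L' ≤ s' * L

≼-trans : ∀ a L wi mi w m → 1 ≤ mi →
          (a , L) ≼ (wi , mi) → (wi , mi) ≼ (w , m) → (a , L) ≼ (w , m)
≼-trans a L wi mi w m mi≥1 h₁ h₂ = *-cancelʳ-≤ (a * m) (w * L) mi {{>-nonZero mi≥1}} (begin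
    a * m * mi    ≡⟨ swap a m mi ⟩
    a * mi * m    ≤⟨ *-monoˡ-≤ m h₁ ⟩
    wi * L * m    ≡⟨ swap wi L m ⟩
    wi * m * L    ≤⟨ *-monoˡ-≤ L h₂ ⟩
    w * mi * L    ≡⟨ swap w mi L ⟩
    w * L * mi    ∎)
  where
    open ≤-Reasoning
    swap : ∀ x y z → x * y * z ≡ x * z * y
    swap = solve-∀

mediant : ∀ w₁ m₁ w₂ m₂ → (w₁ , m₁) ≼ (w₁ + w₂ , m₁ + m₂) ⊎ (w₂ , m₂) ≼ (w₁ + w₂ , m₁ + m₂)
mediant w₁ m₁ w₂ m₂ with w₁ * (m₁ + m₂) ≤? (w₁ + w₂) * m₁
... | yes le = inj₁ le
... | no nle = inj₂ (begin
      w₂ * (m₁ + m₂)        ≡⟨ *-distribˡ-+ w₂ m₁ m₂ ⟩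
      w₂ * m₁ + w₂ * m₂     ≤⟨ +-monoˡ-≤ (w₂ * m₂) (<⇒≤ lt) ⟩
      w₁ * m₂ + w₂ * m₂     ≡⟨ sym (*-distribʳ-+ m₂ w₁ w₂) ⟩
      (w₁ + w₂) * m₂        ∎)
  where
    open ≤-Reasoning
    lt : w₂ * m₁ < w₁ * m₂
    lt = +-cancelˡ-< (w₁ * m₁) (w₂ * m₁) (w₁ * m₂)
           (subst₂ _<_ (*-distribʳ-+ m₁ w₁ w₂) (*-distribˡ-+ w₁ m₁ m₂) (≰⇒> nle))

module _ (P : ℕ × ℕ → Set) (P? : ∀ x → Dec (P x)) (pos : ∀ {x} → P x → 1 ≤ proj₂ x) where

  argmin : (xs : List (ℕ × ℕ)) → (¬ ∃ λ x → x ∈ xs × P x) ⊎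
           (∃ λ y → P y × (∀ x → x ∈ xs → P x → y ≼ x))
  argmin [] = inj₁ λ { (_ , () , _) }
  argmin (x ∷ xs) with argmin xs | P? x
  ... | inj₁ none | no ¬px =
        inj₁ λ { (_ , here refl , px) → ¬px px ; (z , there z∈ , pz) → none (z , z∈ , pz) }
  ... | inj₁ none | yes px =
        inj₂ (x , px , λ { _ (here refl) _ → ≤-refl ; z (there z∈) pz → ⊥-elim (none (z , z∈ , pz)) })
  ... | inj₂ (y , py , least) | no ¬px =
        inj₂ (y , py , λ { _ (here refl) px → ⊥-elim (¬px px) ; z (there z∈) pz → least z z∈ pz })
  ... | inj₂ ((sy , Ly) , py , least) | yes px with proj₁ x * Ly ≤? sy * proj₂ x
  ...   | yes x≼y = inj₂ (x , px , λ
            { _ (here refl) _ → ≤-refl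
            ; (sz , Lz) (there z∈) pz →
                ≼-trans (proj₁ x) (proj₂ x) sy Ly sz Lz (pos py) x≼y (least (sz , Lz) z∈ pz) })
  ...   | no x⋠y = inj₂ ((sy , Ly) , py , λ
            { _ (here refl) _ → ≰⇒≥ x⋠y
            ; z (there z∈) pz → least z z∈ pz })

  fractionsUpTo : ℕ → ℕ → List (ℕ × ℕ)
  fractionsUpTo S N = cartesianProduct (upTo (suc S)) (upTo (suc N))

  ∈-fractionsUpTo : ∀ {S N s L} → s ≤ S → L ≤ N → (s , L) ∈ fractionsUpTo S N
  ∈-fractionsUpTo s≤S L≤N = ∈-cartesianProduct⁺ (∈-upTo⁺ (s≤s s≤S)) (∈-upTo⁺ (s≤s L≤N))

  least-fraction : ∀ S N → (∀ {s L} → P (s , L) → s ≤ S × L ≤ N) → (∃ λ x → P x) →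
                   ∃ λ y → P y × (∀ x → P x → y ≼ x)
  least-fraction S N bounded ((s , L) , px) with argmin (fractionsUpTo S N)
  ... | inj₁ none = ⊥-elim (none ((s , L) , uncurry ∈-fractionsUpTo (bounded px) , px))
  ... | inj₂ (y , py , least) =
        y , py , λ z pz → least z (uncurry ∈-fractionsUpTo (bounded pz)) pz

consFun : ∀ {m} → ℕ → (Fin m → ℕ) → Fin (suc m) → ℕ
consFun x g zero    = x
consFun x g (suc i) = g i

bounded-function? : ∀ m B (P : (Fin m → ℕ) → Set) → (∀ f → Dec (P f)) →
                    (∀ f g → (∀ i → f i ≡ g i) → P f → P g) →
                    Dec (∃ λ f → (∀ i → f i < B) × P f)
bounded-function? zero B P P? ext with P? (λ ())
... | yes pf = yes ((λ ()) , (λ ()) , pf)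
... | no ¬pf = no λ { (f , _ , pf) → ¬pf (ext f (λ ()) (λ ()) pf) }
bounded-function? (suc m) B P P? ext with anyUpTo? (λ x → tail? x) B
  where
    tail? : ∀ x → Dec (∃ λ g → (∀ i → g i < B) × P (consFun x g))
    tail? x = bounded-function? m B (λ g → P (consFun x g)) (λ g → P? (consFun x g))
                (λ g g' e → ext (consFun x g) (consFun x g') λ { zero → refl ; (suc i) → e i })
... | yes (x , x<B , g , g<B , pg) = yes (consFun x g , (λ { zero → x<B ; (suc i) → g<B i }) , pg)
... | no none = no λ { (f , f<B , pf) →
        none (f zero , f<B zero , (λ i → f (suc i)) , (λ i → f<B (suc i)) ,
              ext f (consFun (f zero) (λ i → f (suc i))) (λ { zero → refl ; (suc i) → refl }) pf) }

InBox : ∀ {m} → (Fin m → ℕ) → Vec ℕ m → Set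
InBox B q = ∀ j → 1 ≤ lookup q j × lookup q j ≤ B j

encode : ∀ {m} (B : Fin m → ℕ) (q : Vec ℕ m) → InBox B q → Fin (ΠFin m B)
encode {zero}  B []           _  = zero
encode {suc m} B (zero ∷ q)   bx = ⊥-elim (1+n≰n (proj₁ (bx zero)))
encode {suc m} B (suc x ∷ q)  bx =
  combine (fromℕ< (proj₂ (bx zero))) (encode (λ j → B (suc j)) q (λ j → bx (suc j)))

encode-injective : ∀ {m} (B : Fin m → ℕ) (q q' : Vec ℕ m) (b : InBox B q) (b' : InBox B q') →
                   encode B q b ≡ encode B q' b' → q ≡ q'
encode-injective {zero}  B [] [] b b' e = refl
encode-injective {suc m} B (zero ∷ q) _ b _ e = ⊥-elim (1+n≰n (proj₁ (b zero)))
encode-injective {suc m} B (suc x ∷ q) (zero ∷ q') b b' e = ⊥-elim (1+n≰n (proj₁ (b' zero)))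
encode-injective {suc m} B (suc x ∷ q) (suc y ∷ q') b b' e with combine-injective _ _ _ _ e
... | e₁ , e₂ = cong₂ _∷_
        (cong suc (trans (sym (toℕ-fromℕ< (proj₂ (b zero))))
                  (trans (cong toℕ e₁) (toℕ-fromℕ< (proj₂ (b' zero))))))
        (encode-injective (λ j → B (suc j)) q q' (λ j → b (suc j)) (λ j → b' (suc j)) e₂)

unique-lookup : ∀ {A : Set} {xs : List A} → Unique xs →
                (i j : Fin (length xs)) → i F.< j → L.lookup xs i ≢ L.lookup xs j
unique-lookup {xs = x ∷ xs} (x∉xs ∷ _) zero    (suc j) _   eq = All.lookup x∉xs (∈-lookup j) eq
unique-lookup {xs = x ∷ xs} (_ ∷ u)    (suc i) (suc j) i<j eq = unique-lookup u i j (s<s⁻¹ i<j) eq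

unique-box-length : ∀ {m} (B : Fin m → ℕ) (qs : List (Vec ℕ m)) →
                    (∀ {q} → q ∈ qs → InBox B q) → Unique qs → length qs ≤ ΠFin m B
unique-box-length B qs inBox u with length qs ≤? ΠFin _ B
... | yes le = le
... | no nle with pigeonhole (≰⇒> nle) (λ i → encode B (L.lookup qs i) (inBox (∈-lookup i)))
... | i , j , i<j , e = ⊥-elim (unique-lookup u i j i<j (encode-injective B _ _ _ _ e))

vec-ext : ∀ {m} (x y : Vec ℕ m) → (∀ j → lookup x j ≡ lookup y j) → x ≡ y
vec-ext x y e = trans (sym (tabulate∘lookup x)) (trans (tabulate-cong e) (tabulate∘lookup y))

-- Walks in this graph encode the base-p
-- expansions of the vectors U in the sets E_D(m).

module DigitGraph (k : ℕ) {n r : ℕ} (D : Fin n → Vec ℕ r) where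
  open Digits k public

  Digit : Set
  Digit = Fin n → ℕ

  IsDigit : Digit → Set
  IsDigit a = ∀ i → a i < p

  State : Vec ℕ r → Set
  State = InBox (colSum D)

  Step : Vec ℕ r → Digit → Vec ℕ r → Set
  Step q a q' = ∀ j → p * lookup q' j ≡ lookup q j + weighted D a j

  data Walk : Vec ℕ r → List Digit → Vec ℕ r → Set where
    nil  : ∀ {q} → State q → Walk q [] q
    cons : ∀ {q q' e a as} → State q → IsDigit a → Step q a q' → Walk q' as e → Walk q (a ∷ as) e

  number : List Digit → Digit
  number []       i = 0
  number (a ∷ as) i = a i + p * number as i

  weight : List Digit → ℕ
  weight []       = 0
  weight (a ∷ as) = ΣFin n a + weight as

  weight-++ : ∀ xs ys → weight (xs ++ ys) ≡ weight xs + weight ys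
  weight-++ []       ys = refl
  weight-++ (x ∷ xs) ys =
    trans (cong (ΣFin n x +_) (weight-++ xs ys)) (sym (+-assoc (ΣFin n x) (weight xs) (weight ys)))

  weighted-digit-cons : ∀ (a b : Digit) j →
                        weighted D (λ i → a i + p * b i) j ≡ weighted D a j + p * weighted D b j
  weighted-digit-cons a b j = begin
      ΣFin n (λ i → (a i + p * b i) * entry D i j)
        ≡⟨ ΣFin-cong n (λ i → distrib (a i) (b i) (entry D i j) p) ⟩
      ΣFin n (λ i → a i * entry D i j + p * (b i * entry D i j))
        ≡⟨ ΣFin-+ n (λ i → a i * entry D i j) (λ i → p * (b i * entry D i j)) ⟩
      weighted D a j + ΣFin n (λ i → p * (b i * entry D i j))
        ≡⟨ cong (weighted D a j +_) (ΣFin-* n p (λ i → b i * entry D i j)) ⟩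
      weighted D a j + p * weighted D b j ∎
    where
      open ≡-Reasoning
      distrib : ∀ x y d c → (x + c * y) * d ≡ x * d + c * (y * d)
      distrib = solve-∀

  weighted-euclid : ∀ (h : Digit) j →
                    weighted D (λ i → h i % p) j + p * weighted D (λ i → h i / p) j ≡ weighted D h j
  weighted-euclid h j =
    trans (sym (weighted-digit-cons (λ i → h i % p) (λ i → h i / p) j))
          (ΣFin-cong n (λ i → cong (_* entry D i j) (sym (euclid (h i)))))

  weighted-digit-≤ : ∀ a → IsDigit a → ∀ j → weighted D a j ≤ suc k * colSum D j
  weighted-digit-≤ a a<p j = begin
      ΣFin n (λ i → a i * entry D i j)       ≤⟨ ΣFin-mono n (λ i → *-monoˡ-≤ (entry D i j) (≤-pred (a<p i))) ⟩
      ΣFin n (λ i → suc k * entry D i j)     ≡⟨ ΣFin-* n (suc k) (λ i → entry D i j) ⟩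
      suc k * colSum D j                     ∎
    where open ≤-Reasoning

  step-state : ∀ {q a q'} → State q → IsDigit a → Step q a q' → State q'
  step-state {q} {a} {q'} q∈ a<p step j = lower , upper
    where
      lower : 1 ≤ lookup q' j
      lower with lookup q' j in q'j
      ... | zero  = ⊥-elim (<⇒≢ (≤-trans (proj₁ (q∈ j)) (m≤m+n _ (weighted D a j)))
                      (sym (trans (sym (step j)) (trans (cong (p *_) q'j) (*-zeroʳ p)))))
      ... | suc _ = s≤s z≤n
      upper : lookup q' j ≤ colSum D j
      upper = *-cancelˡ-≤ p (subst (_≤ p * colSum D j) (sym (step j))
                (+-mono-≤ (proj₂ (q∈ j)) (weighted-digit-≤ a a<p j)))

  number-< : ∀ {q as e} → Walk q as e → ∀ i → number as i < p ^ length as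
  number-< (nil _) i = s≤s z≤n
  number-< {as = a ∷ as} (cons _ a<p _ w) i =
    digit-cons-< (length as) (a i) (number as i) (a<p i) (number-< w i)

  σpU-number : ∀ {q as e} → Walk q as e → σpU p (number as) ≡ weight as
  σpU-number (nil _) = ΣFin-zero n (λ _ → refl)
  σpU-number {as = a ∷ as} (cons _ a<p _ w) = begin
      ΣFin n (λ i → σp p (a i + p * number as i))
        ≡⟨ ΣFin-cong n (λ i → σp-digit-cons (length as) (a i) (number as i) (a<p i) (number-< w i)) ⟩
      ΣFin n (λ i → a i + σp p (number as i))
        ≡⟨ ΣFin-+ n a (λ i → σp p (number as i)) ⟩
      ΣFin n a + σpU p (number as)
        ≡⟨ cong (ΣFin n a +_) (σpU-number w) ⟩
      ΣFin n a + weight as ∎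
    where open ≡-Reasoning

  telescope : ∀ {q as e} → Walk q as e → ∀ j →
              weighted D (number as) j + lookup q j ≡ p ^ length as * lookup e j
  telescope (nil _) j = trans (cong (_+ _) (ΣFin-zero n (λ _ → refl))) (sym (+-identityʳ _))
  telescope {q} {a ∷ as} {e} (cons {q' = q'} _ _ step w) j = begin
      weighted D (number (a ∷ as)) j + lookup q j
        ≡⟨ cong (_+ lookup q j) (weighted-digit-cons a (number as) j) ⟩
      weighted D a j + p * W' + lookup q j       ≡⟨ rearrange (weighted D a j) (p * W') (lookup q j) ⟩
      (lookup q j + weighted D a j) + p * W'     ≡⟨ cong (_+ p * W') (sym (step j)) ⟩
      p * lookup q' j + p * W'                   ≡⟨ sym (*-distribˡ-+ p (lookup q' j) W') ⟩
      p * (lookup q' j + W')                     ≡⟨ cong (p *_) (+-comm (lookup q' j) W') ⟩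
      p * (W' + lookup q' j)                     ≡⟨ cong (p *_) (telescope w j) ⟩
      p * (p ^ length as * lookup e j)           ≡⟨ sym (*-assoc p (p ^ length as) (lookup e j)) ⟩
      p ^ length (a ∷ as) * lookup e j           ∎
    where
      open ≡-Reasoning
      W' = weighted D (number as) j
      rearrange : ∀ x y z → x + y + z ≡ z + x + y
      rearrange = solve-∀

  walk-start : ∀ {q as e} → Walk q as e → State q
  walk-start (nil q∈)         = q∈
  walk-start (cons q∈ _ _ _)  = q∈

  closed-walk-weighted : ∀ {q as} → Walk q as q → ∀ j →
                         weighted D (number as) j ≡ lookup q j * (p ^ length as ∸ 1)
  closed-walk-weighted {q} {as} w j = begin
      W                               ≡⟨ sym (m+n∸n≡m W (lookup q j)) ⟩
      W + lookup q j ∸ lookup q j     ≡⟨ cong (_∸ lookup q j) (telescope w j) ⟩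
      P * lookup q j ∸ lookup q j     ≡⟨ cong (P * lookup q j ∸_) (sym (*-identityˡ (lookup q j))) ⟩
      P * lookup q j ∸ 1 * lookup q j ≡⟨ sym (*-distribʳ-∸ (lookup q j) P 1) ⟩
      (P ∸ 1) * lookup q j            ≡⟨ *-comm (P ∸ 1) (lookup q j) ⟩
      lookup q j * (P ∸ 1)            ∎
    where
      open ≡-Reasoning
      W = weighted D (number as) j
      P = p ^ length as

  -- Hence a closed walk of positive length L yields an element of E_D(L);
  -- some coordinate j₀ is needed to see that this element is nonzero.
  closedWalk⇒InE : Fin r → ∀ {q as} → Walk q as q → 1 ≤ length as →
                   InE p D (length as) (number as)
  closedWalk⇒InE j₀ {q} {as} w L≥1 = number-< w , nonzero , divisible , positive
    where
      divisible : ∀ j → (p ^ length as ∸ 1) ∣ weighted D (number as) j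
      divisible j = divides (lookup q j) (closed-walk-weighted w j)
      positive : ∀ j → 0 < weighted D (number as) j
      positive j = subst (0 <_) (sym (closed-walk-weighted w j))
                     (*-mono-≤ (proj₁ (walk-start w j)) (1≤p^L∸1 (length as) L≥1))
      nonzero : ¬ (∀ i → number as i ≡ 0)
      nonzero all0 = <⇒≢ (positive j₀) (sym (ΣFin-zero n (λ i → cong (_* entry D i j₀) (all0 i))))

  weight-≤ : ∀ {q as e} → Walk q as e → weight as ≤ length as * (n * p)
  weight-≤ (nil _) = z≤n
  weight-≤ {as = a ∷ as} (cons _ a<p _ w) = begin
      ΣFin n a + weight as                     ≤⟨ +-mono-≤ (ΣFin-mono n (λ i → <⇒≤ (a<p i))) (weight-≤ w) ⟩
      ΣFin n (λ _ → p) + length as * (n * p)   ≡⟨ cong (_+ length as * (n * p)) (ΣFin-const n p) ⟩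
      suc (length as) * (n * p)                ∎
    where open ≤-Reasoning

  peel-digit : ∀ ℓ (h : Digit) (q e : Vec ℕ r) → State q →
               (∀ j → weighted D h j + lookup q j ≡ p ^ suc ℓ * lookup e j) →
               ∃ λ q' → Step q (λ i → h i % p) q' × State q' ×
                        (∀ j → weighted D (λ i → h i / p) j + lookup q' j ≡ p ^ ℓ * lookup e j)
  peel-digit ℓ h q e q∈ inv =
    q' , step , step-state {q} {_} {q'} q∈ (λ i → m%n<n (h i) p) step , inv'
    where
      V W' X : Fin r → ℕ
      V j  = weighted D (λ i → h i % p) j
      W' j = weighted D (λ i → h i / p) j
      X j  = p ^ ℓ * lookup e j
      total : ∀ j → V j + p * W' j + lookup q j ≡ p * X j
      total j = begin
          V j + p * W' j + lookup q j      ≡⟨ cong (_+ lookup q j) (weighted-euclid h j) ⟩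
          weighted D h j + lookup q j      ≡⟨ inv j ⟩
          p * p ^ ℓ * lookup e j           ≡⟨ *-assoc p (p ^ ℓ) (lookup e j) ⟩
          p * X j                          ∎
        where open ≡-Reasoning
      W'≤X : ∀ j → W' j ≤ X j
      W'≤X j = *-cancelˡ-≤ p (subst (p * W' j ≤_) (total j)
                 (≤-trans (m≤n+m (p * W' j) (V j)) (m≤m+n _ (lookup q j))))
      q' : Vec ℕ r
      q' = tabulate (λ j → X j ∸ W' j)
      step : Step q (λ i → h i % p) q'
      step j = begin
          p * lookup q' j                            ≡⟨ cong (p *_) (lookup∘tabulate _ j) ⟩
          p * (X j ∸ W' j)                           ≡⟨ *-distribˡ-∸ p (X j) (W' j) ⟩
          p * X j ∸ p * W' j                         ≡⟨ cong (_∸ p * W' j) (sym (total j)) ⟩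
          V j + p * W' j + lookup q j ∸ p * W' j
            ≡⟨ cong (_∸ p * W' j) (rearrange (V j) (p * W' j) (lookup q j)) ⟩
          lookup q j + V j + p * W' j ∸ p * W' j     ≡⟨ m+n∸n≡m _ (p * W' j) ⟩
          lookup q j + V j                           ∎
        where
          open ≡-Reasoning
          rearrange : ∀ x y z → x + y + z ≡ z + x + y
          rearrange = solve-∀
      inv' : ∀ j → W' j + lookup q' j ≡ X j
      inv' j = trans (cong (W' j +_) (lookup∘tabulate _ j)) (m+[n∸m]≡n (W'≤X j))

  digit-walk : ∀ ℓ (h : Digit) (q e : Vec ℕ r) → (∀ i → h i < p ^ ℓ) → State q →
               (∀ j → weighted D h j + lookup q j ≡ p ^ ℓ * lookup e j) →
               ∃ λ as → Walk q as e × length as ≡ ℓ × (∀ i → number as i ≡ h i)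
  digit-walk zero h q e h<1 q∈ inv = [] , subst (Walk q []) q≡e (nil q∈) , refl , λ i → sym (h≗0 i)
    where
      h≗0 : ∀ i → h i ≡ 0
      h≗0 i = n<1⇒n≡0 (h<1 i)
      q≡e : q ≡ e
      q≡e = vec-ext q e λ j → begin
          lookup q j                     ≡⟨ cong (_+ lookup q j) (sym (ΣFin-zero n (λ i → cong (_* entry D i j) (h≗0 i)))) ⟩
          weighted D h j + lookup q j    ≡⟨ inv j ⟩
          1 * lookup e j                 ≡⟨ *-identityˡ (lookup e j) ⟩
          lookup e j                     ∎
        where open ≡-Reasoning
  digit-walk (suc ℓ) h q e h<p^ℓ q∈ inv with peel-digit ℓ h q e q∈ inv
  ... | q' , step , q'∈ , inv'
    with digit-walk ℓ (λ i → h i / p) q' e (λ i → /p-< ℓ (h i) (h<p^ℓ i)) q'∈ inv'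
  ... | as , w , len , num =
        (λ i → h i % p) ∷ as , cons q∈ (λ i → m%n<n (h i) p) step w , cong suc len ,
        λ i → trans (cong (λ x → h i % p + p * x) (num i)) (sym (euclid (h i)))

  quotient-bounds : ∀ (U : Digit) j c P → 1 ≤ P → (∀ i → U i ≤ P) → 0 < weighted D U j →
                    weighted D U j ≡ c * P → 1 ≤ c × c ≤ colSum D j
  quotient-bounds U j zero    P P≥1 U≤P positive eq = ⊥-elim (<⇒≢ positive (sym eq))
  quotient-bounds U j (suc c) P P≥1 U≤P positive eq =
      s≤s z≤n , *-cancelʳ-≤ (suc c) (colSum D j) P {{>-nonZero P≥1}} (begin
        suc c * P                           ≡⟨ sym eq ⟩
        ΣFin n (λ i → U i * entry D i j)    ≤⟨ ΣFin-mono n (λ i → *-monoˡ-≤ (entry D i j) (U≤P i)) ⟩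
        ΣFin n (λ i → P * entry D i j)      ≡⟨ ΣFin-* n P (λ i → entry D i j) ⟩
        P * colSum D j                      ≡⟨ *-comm P (colSum D j) ⟩
        colSum D j * P                      ∎)
    where open ≤-Reasoning

  -- Conversely, U ∈ E_D(m) is the number of a closed walk of length m,
  -- through the state c with Σ_i u_i d_ij = c_j · (p^m - 1).
  InE⇒closedWalk : ∀ m U → 1 ≤ m → InE p D m U →
                   ∃ λ q → ∃ λ as → Walk q as q × length as ≡ m × (∀ i → number as i ≡ U i)
  InE⇒closedWalk m U m≥1 (U<p^m , _ , divisible , positive) = c , digit-walk m U c c U<p^m c∈ inv
    where
      P = p ^ m ∸ 1
      quot : Fin r → ℕ
      quot j = _∣_.quotient (divisible j)
      c : Vec ℕ r
      c = tabulate quot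
      c∈ : State c
      c∈ j rewrite lookup∘tabulate quot j =
        quotient-bounds U j (quot j) P (1≤p^L∸1 m m≥1) (λ i → ∸-monoˡ-≤ 1 (U<p^m i)) (positive j)
                        (_∣_.equality (divisible j))
      inv : ∀ j → weighted D U j + lookup c j ≡ p ^ m * lookup c j
      inv j rewrite lookup∘tabulate quot j = begin
          weighted D U j + quot j
            ≡⟨ cong₂ _+_ (_∣_.equality (divisible j)) (sym (*-identityʳ (quot j))) ⟩
          quot j * P + quot j * 1       ≡⟨ sym (*-distribˡ-+ (quot j) P 1) ⟩
          quot j * (P + 1)              ≡⟨ cong (quot j *_) (m∸n+n≡m (m^n>0 p m)) ⟩
          quot j * p ^ m                ≡⟨ *-comm (quot j) (p ^ m) ⟩
          p ^ m * quot j                ∎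
        where open ≡-Reasoning

  N : ℕ
  N = ΠFin r (colSum D)

  data Cycle : ℕ → ℕ → Set where
    cycle : ∀ {q as} → Walk q as q → Cycle (length as) (weight as)

  states : ∀ {q as e} → Walk q as e → List (Vec ℕ r)
  states (nil _)              = []
  states (cons {q} _ _ _ w)   = q ∷ states w

  length-states : ∀ {q as e} (w : Walk q as e) → length (states w) ≡ length as
  length-states (nil _)          = refl
  length-states (cons _ _ _ w)   = cong suc (length-states w)

  states-State : ∀ {q as e} (w : Walk q as e) → ∀ {s} → s ∈ states w → State s
  states-State (cons q∈ _ _ _) (here refl) = q∈
  states-State (cons _ _ _ w)  (there s∈)  = states-State w s∈

  append : ∀ {q xs s ys e} → Walk q xs s → Walk s ys e → Walk q (xs ++ ys) e
  append (nil _)             w₂ = w₂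
  append (cons q∈ a step w)  w₂ = cons q∈ a step (append w w₂)

  split-at : ∀ {q as e s} (w : Walk q as e) → s ∈ states w →
             ∃ λ xs → ∃ λ ys → as ≡ xs ++ ys × Walk q xs s × Walk s ys e × 1 ≤ length ys
  split-at (cons q∈ a step w) (here refl) = [] , _ , refl , nil q∈ , cons q∈ a step w , s≤s z≤n
  split-at {as = a ∷ as} (cons q∈ a<p step w) (there s∈) with split-at w s∈
  ... | xs , ys , eq , w₁ , w₂ , ys≥1 = a ∷ xs , ys , cong (a ∷_) eq , cons q∈ a<p step w₁ , w₂ , ys≥1

  record Repetition (q : Vec ℕ r) (as : List Digit) (e : Vec ℕ r) : Set where
    field
      s        : Vec ℕ r
      xs ys zs : List Digit
      split    : as ≡ xs ++ ys ++ zs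
      before   : Walk q xs s
      loop     : Walk s ys s
      after    : Walk s zs e
      ys≥1     : 1 ≤ length ys
      zs≥1     : 1 ≤ length zs

  open DecMembership (≡-dec {n = r} _≟_) using (_∈?_)

  repetition : ∀ {q as e} (w : Walk q as e) → Unique (states w) ⊎ Repetition q as e
  repetition (nil _) = inj₁ []
  repetition {q} {a ∷ as} (cons q∈ a<p step w) with repetition w
  ... | inj₂ R = inj₂ (record { s = s ; xs = a ∷ xs ; ys = ys ; zs = zs ; split = cong (a ∷_) split
                              ; before = cons q∈ a<p step before ; loop = loop ; after = after
                              ; ys≥1 = ys≥1 ; zs≥1 = zs≥1 })
    where open Repetition R
  ... | inj₁ distinct with q ∈? states w
  ...   | no q∉ = inj₁ (¬Any⇒All¬ (states w) q∉ ∷ distinct)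
  ...   | yes q∈w with split-at w q∈w
  ...     | xs , ys , eq , w₁ , w₂ , ys≥1 = inj₂ (record
              { s = q ; xs = [] ; ys = a ∷ xs ; zs = ys ; split = cong (a ∷_) eq
              ; before = nil q∈ ; loop = cons q∈ a<p step w₁ ; after = w₂ ; ys≥1 = s≤s z≤n ; zs≥1 = ys≥1 })

  rotate-middle : (f : List Digit → ℕ) → (∀ xs ys → f (xs ++ ys) ≡ f xs + f ys) →
                  ∀ xs ys zs → f (xs ++ ys ++ zs) ≡ f ys + f (xs ++ zs)
  rotate-middle f f-++ xs ys zs = begin
      f (xs ++ ys ++ zs)        ≡⟨ f-++ xs (ys ++ zs) ⟩
      f xs + f (ys ++ zs)       ≡⟨ cong (f xs +_) (f-++ ys zs) ⟩
      f xs + (f ys + f zs)      ≡⟨ +-exchange (f xs) (f ys) (f zs) ⟩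
      f ys + (f xs + f zs)      ≡⟨ cong (f ys +_) (sym (f-++ xs zs)) ⟩
      f ys + f (xs ++ zs)       ∎
    where
      open ≡-Reasoning
      +-exchange : ∀ x y z → x + (y + z) ≡ y + (x + z)
      +-exchange = solve-∀

  data Splitting : ℕ → ℕ → Set where
    splitting : ∀ {m₁ w₁ m₂ w₂} → Cycle m₁ w₁ → Cycle m₂ w₂ → 1 ≤ m₁ → 1 ≤ m₂ →
                Splitting (m₁ + m₂) (w₁ + w₂)

  split-cycle : ∀ {m w} → Cycle m w → N < m → Splitting m w
  split-cycle (cycle w) N<m with repetition w
  ... | inj₁ distinct = ⊥-elim (<⇒≱ N<m (subst (_≤ N) (length-states w)
                          (unique-box-length (colSum D) (states w) (states-State w) distinct)))
  ... | inj₂ R = subst₂ Splitting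
        (sym (trans (cong length split) (rotate-middle length (λ xs _ → length-++ xs) xs ys zs)))
        (sym (trans (cong weight split) (rotate-middle weight weight-++ xs ys zs)))
        (splitting (cycle loop) (cycle (append before after)) ys≥1
                   (≤-trans zs≥1 (subst (length zs ≤_) (sym (length-++ xs)) (m≤n+m _ (length xs)))))
    where open Repetition R

  ShortCycleBelow : ℕ → ℕ → Set
  ShortCycleBelow w m = ∃ λ L → ∃ λ w' → Cycle L w' × 1 ≤ L × L ≤ N × (w' , L) ≼ (w , m)

  short-cycle-below-≼ : ∀ {wᵢ mᵢ w m} → 1 ≤ mᵢ → (wᵢ , mᵢ) ≼ (w , m) →
                        ShortCycleBelow wᵢ mᵢ → ShortCycleBelow w m
  short-cycle-below-≼ {wᵢ} {mᵢ} {w} {m} mᵢ≥1 ≼wm (L , w' , c , L≥1 , L≤N , w'≼) =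
    L , w' , c , L≥1 , L≤N , ≼-trans w' L wᵢ mᵢ w m mᵢ≥1 w'≼ ≼wm

  -- Every closed walk of positive length is bounded below by a short one:
  -- split it while it is longer than N, keeping the part of smaller ratio.
  reduce-cycle : ∀ fuel {m w} → m ≤ fuel → 1 ≤ m → Cycle m w → ShortCycleBelow w m
  reduce-cycle zero m≤0 m≥1 _ = ⊥-elim (1+n≰n (≤-trans m≥1 m≤0))
  reduce-cycle (suc fuel) {m} {w} m≤fuel m≥1 c with m ≤? N
  ... | yes m≤N = m , w , c , m≥1 , m≤N , ≤-refl
  ... | no m≰N with split-cycle c (≰⇒> m≰N)
  ... | splitting {m₁} {w₁} {m₂} {w₂} c₁ c₂ m₁≥1 m₂≥1 with mediant w₁ m₁ w₂ m₂
  ...   | inj₁ better = short-cycle-below-≼ {w₁} {m₁} {w} {m} m₁≥1 better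
                          (reduce-cycle fuel (≤-pred (≤-trans (m<m+n m₁ m₂≥1) m≤fuel)) m₁≥1 c₁)
  ...   | inj₂ better = short-cycle-below-≼ {w₂} {m₂} {w} {m} m₂≥1 better
                          (reduce-cycle fuel (≤-pred (≤-trans (m<n+m m₂ m₁≥1) m≤fuel)) m₂≥1 c₂)

-- Call a fraction s / L admissible when
-- 1 ≤ L ≤ N, s ≤ N · n · p and s = σ_p(U) for some U ∈ E_D(L).  There are
-- finitely many and they are decidable, so a least one exists; by
-- reduce-cycle it lies below every ratio σ_p(U) / m with U ∈ E_D(m).

module LeastRatio (k : ℕ) {n r : ℕ} (D : Fin n → Vec ℕ r) (j₀ : Fin r)
                  (columns : ∀ j → ∃ λ i → 0 < entry D i j) where
  open DigitGraph k D

  S : ℕ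
  S = N * (n * p)

  Realised : ℕ → ℕ → Set
  Realised s L = ∃ λ U → InE p D L U × σpU p U ≡ s

  Admissible : ℕ × ℕ → Set
  Admissible (s , L) = s ≤ S × 1 ≤ L × L ≤ N × Realised s L

  InE? : ∀ L U → Dec (InE p D L U)
  InE? L U = all? (λ i → U i <? p ^ L) ×-dec ¬? (all? (λ i → U i ≟ 0)) ×-dec
             all? (λ j → (p ^ L ∸ 1) ∣? weighted D U j) ×-dec all? (λ j → 0 <? weighted D U j)

  realised-ext : ∀ s L (U U' : Fin n → ℕ) → (∀ i → U i ≡ U' i) →
                 InE p D L U × σpU p U ≡ s → InE p D L U' × σpU p U' ≡ s
  realised-ext s L U U' U≗U' ((U<p^L , nonzero , divisible , positive) , σ≡) =
      ((λ i → subst (_< p ^ L) (U≗U' i) (U<p^L i)) ,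
       (λ all0 → nonzero (λ i → trans (U≗U' i) (all0 i))) ,
       (λ j → subst ((p ^ L ∸ 1) ∣_) (weighted≡ j) (divisible j)) ,
       (λ j → subst (0 <_) (weighted≡ j) (positive j))) ,
      trans (sym (ΣFin-cong n (λ i → cong (σp p) (U≗U' i)))) σ≡
    where
      weighted≡ : ∀ j → weighted D U j ≡ weighted D U' j
      weighted≡ j = ΣFin-cong n (λ i → cong (_* entry D i j) (U≗U' i))

  realised? : ∀ s L → Dec (Realised s L)
  realised? s L = map′ (λ (U , _ , R) → U , R) (λ (U , R) → U , proj₁ (proj₁ R) , R)
    (bounded-function? n (p ^ L) (λ U → InE p D L U × σpU p U ≡ s)
                       (λ U → InE? L U ×-dec (σpU p U ≟ s)) (realised-ext s L))

  admissible? : ∀ x → Dec (Admissible x)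
  admissible? (s , L) = (s ≤? S) ×-dec (1 ≤? L) ×-dec (L ≤? N) ×-dec realised? s L

  cycle-admissible : ∀ {L w} → Cycle L w → 1 ≤ L → L ≤ N → Admissible (w , L)
  cycle-admissible (cycle {as = as} w) L≥1 L≤N =
    ≤-trans (weight-≤ w) (*-monoˡ-≤ (n * p) L≤N) , L≥1 , L≤N ,
    number as , closedWalk⇒InE j₀ w L≥1 , σpU-number w

  InE⇒cycle : ∀ m U → 1 ≤ m → InE p D m U → Cycle m (σpU p U)
  InE⇒cycle m U m≥1 U∈E with InE⇒closedWalk m U m≥1 U∈E
  ... | q , as , w , refl , number≗U =
        subst (Cycle (length as))
              (trans (sym (σpU-number w)) (ΣFin-cong n (λ i → cong (σp p) (number≗U i))))
              (cycle w)

  admissible-below : ∀ m U → 1 ≤ m → InE p D m U → ∃ λ x → Admissible x × x ≼ (σpU p U , m)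
  admissible-below m U m≥1 U∈E with reduce-cycle m ≤-refl m≥1 (InE⇒cycle m U m≥1 U∈E)
  ... | L , w , c , L≥1 , L≤N , w≼ = (w , L) , cycle-admissible c L≥1 L≤N , w≼

  -- The state (D_1, …, D_r) carries a loop with all digits p - 1.
  loop-admissible : ∃ λ x → Admissible x
  loop-admissible = (weight (top ∷ []) , 1) , cycle-admissible (cycle loop) ≤-refl N≥1
    where
      D-positive : ∀ j → 1 ≤ colSum D j
      D-positive j = ≤-trans (proj₂ (columns j)) (ΣFin-summand n (λ i → entry D i j) (proj₁ (columns j)))
      N≥1 : 1 ≤ N
      N≥1 = ΠFin-positive r (colSum D) D-positive
      c : Vec ℕ r
      c = tabulate (colSum D)
      c∈ : State c
      c∈ j rewrite lookup∘tabulate (colSum D) j = D-positive j , ≤-refl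
      top : Digit
      top _ = suc k
      step : Step c top c
      step j rewrite lookup∘tabulate (colSum D) j =
        cong (colSum D j +_) (sym (ΣFin-* n (suc k) (λ i → entry D i j)))
      loop : Walk c (top ∷ []) c
      loop = cons c∈ (λ _ → ≤-refl) step (nil c∈)

  least-admissible : ∃ λ y → Admissible y × (∀ x → Admissible x → y ≼ x)
  least-admissible = least-fraction Admissible admissible? (λ a → proj₁ (proj₂ a)) S N
                       (λ a → proj₁ a , proj₁ (proj₂ (proj₂ a))) loop-admissible

  module _ {s₀ m₀ : ℕ} (s₀≤S : s₀ ≤ S) (m₀≥1 : 1 ≤ m₀) (m₀≤N : m₀ ≤ N)
           (least : ∀ x → Admissible x → (s₀ , m₀) ≼ x) where

    -- s₀ bounds σ_p from below on E_D(m₀): smaller sums would give smaller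
    -- admissible fractions, and sums above S exceed s₀ anyway.
    least-σ-minimal : ∀ U → InE p D m₀ U → s₀ ≤ σpU p U
    least-σ-minimal U U∈E with σpU p U ≤? S
    ... | yes σ≤S = *-cancelʳ-≤ s₀ (σpU p U) m₀ {{>-nonZero m₀≥1}}
                      (least (σpU p U , m₀) (σ≤S , m₀≥1 , m₀≤N , U , U∈E , refl))
    ... | no σ≰S  = ≤-trans s₀≤S (<⇒≤ (≰⇒> σ≰S))

    least-below : ∀ m s → 1 ≤ m → IsσpDm p D m s → s₀ * m ≤ s * m₀
    least-below m s m≥1 ((U , U∈E , refl) , _) with admissible-below m U m≥1 U∈E
    ... | (s' , L) , admissible , s'≼ =
          ≼-trans s₀ m₀ s' L (σpU p U) m (proj₁ (proj₂ admissible)) (least (s' , L) admissible) s'≼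

  least-ratio : Σ ℕ λ m₀ → Σ ℕ λ s₀ →
                1 ≤ m₀ × m₀ ≤ N × IsσpDm p D m₀ s₀ ×
                (∀ m s → 1 ≤ m → IsσpDm p D m s → s₀ * m ≤ s * m₀)
  least-ratio with least-admissible
  ... | (s₀ , m₀) , (s₀≤S , m₀≥1 , m₀≤N , realised) , least =
        m₀ , s₀ , m₀≥1 , m₀≤N , (realised , least-σ-minimal s₀≤S m₀≥1 m₀≤N least) ,
        least-below s₀≤S m₀≥1 m₀≤N least

Vec-0-zero : (v : Vec ℕ 0) → v ≡ replicate 0 0
Vec-0-zero [] = refl

mainTheorem4 : (p : ℕ) .{{_ : NonZero p}} → Prime p →
    (n r : ℕ) → (D : Fin (suc n) → Vec ℕ r) →
    Injective _≡_ _≡_ D →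
    (∀ i → D i ≢ replicate r 0) →
    (∀ j → Σ (Fin (suc n)) λ i → 0 < entry D i j) →
    Σ ℕ λ m₀ → Σ ℕ λ s₀ →
      1 ≤ m₀ × m₀ ≤ ΠFin r (colSum D) × IsσpDm p D m₀ s₀ ×
      (∀ m s → 1 ≤ m → IsσpDm p D m s → s₀ * m ≤ s * m₀)
mainTheorem4 zero          p-prime = ⊥-elim (¬prime[0] p-prime)
mainTheorem4 (suc zero)    p-prime = ⊥-elim (¬prime[1] p-prime)
mainTheorem4 (suc (suc k)) _ n zero    D _ nonzero _ = ⊥-elim (nonzero zero (Vec-0-zero (D zero)))
mainTheorem4 (suc (suc k)) _ n (suc r) D _ _ columns = LeastRatio.least-ratio k D zero columns
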